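{- Let $n\geq 1$ and $d\geq 2$ be integers, and let $U$ be any rooted tree such that every rooted tree with exactly $n$ leaves and no node of degree $1$ is a topological minor of $U$. Then the number of nodes of $U$ with at least $d$ children is at least $\sum_{s\geq 2} u\big(\lfloor n/((s-1)(d-1)+1)\rfloor\big)$.
   Context: Trees are finite and rooted, edges directed from parent to child; the degree of a node is its number of children (unbounded). A rooted tree $T$ is a topological minor of a rooted tree $U$ if there is an injective map $f$ from nodes of $T$ to nodes of $U$ with $f(\mathsf{NCA}_T(u,v))=\mathsf{NCA}_U(f(u),f(v))$ for all $u,v$ (equivalently, $U$ contains as a subgraph, respecting root and directions, a subdivision of $T$). For a positive integer $m$, $u(m)$ is the minimum number of leaves of a rooted tree $U'$ such that every rooted tree with exactly $m$ leaves and no node of degree $1$ is a topological minor of $U'$; and $u(0)=0$. -}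

module Defs where

open import Data.Nat using (ℕ; zero; suc; _+_; _*_; _∸_; _≤_; _/_)
open import Data.Nat.Properties using ()
open import Data.Fin using (Fin; toℕ; _≟_)
open import Data.Product using (Σ; ∃; _×_; _,_)
open import Relation.Binary.PropositionalEquality using (_≡_; refl)
open import Relation.Nullary using (¬_; yes; no)
open import Function.Definitions using (Injective)

data Tree : Set where
  node : (k : ℕ) → (Fin k → Tree) → Tree

sumFin : (k : ℕ) → (Fin k → ℕ) → ℕ
sumFin zero    f = 0
sumFin (suc k) f = f Fin.zero + sumFin k (λ i → f (Fin.suc i))

-- Nodes of a tree, addressed by the path from the root.
data Pos : Tree → Set where
  root : ∀ {t} → Pos t
  down : ∀ {k f} (i : Fin k) → Pos (f i) → Pos (node k f)

degree : ∀ {t} → Pos t → ℕ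
degree {node k f} root = k
degree (down i p) = degree p

nca : ∀ {t} → Pos t → Pos t → Pos t
nca root q = root
nca (down i p) root = root
nca (down i p) (down j q) with i ≟ j
... | yes refl = down i (nca p q)
... | no _ = root

leaves : Tree → ℕ
leaves (node zero f) = 1
leaves (node (suc k) f) = sumFin (suc k) (λ i → leaves (f i))

countDeg≥ : ℕ → Tree → ℕ
countDeg≥ d (node k f) = ind + sumFin k (λ i → countDeg≥ d (f i))
  where
  ind : ℕ
  ind with Data.Nat._≤?_ d k
  ... | yes _ = 1
  ... | no _ = 0

NoUnary : Tree → Set
NoUnary t = (p : Pos t) → ¬ (degree p ≡ 1)

-- T is a topological minor of U: an injective map on nodes preserving NCA.
_≼_ : Tree → Tree → Set
T ≼ U = Σ (Pos T → Pos U) λ φ →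
          Injective _≡_ _≡_ φ × (∀ x y → φ (nca x y) ≡ nca (φ x) (φ y))

Universal : ℕ → Tree → Set
Universal m U = (T : Tree) → leaves T ≡ m → NoUnary T → T ≼ U

IsUMin : ℕ → ℕ → Set
IsUMin m k = (Σ Tree λ U → Universal m U × leaves U ≡ k)
           × ((U : Tree) → Universal m U → k ≤ leaves U)

-- Σ_{s ≥ 2} u(⌊n / ((s-1)(d-1)+1)⌋), truncated to s = 2 .. n+1
-- (for s ≥ n+2 the argument is 0 and u 0 = 0). Index i : Fin n gives s - 1 = i + 1.
boundSum : (ℕ → ℕ) → ℕ → ℕ → ℕ
boundSum u n d = sumFin n (λ i → u (n / suc (suc (toℕ i) * (d ∸ 1))))

module Submission where

-- Fix d ≥ 2; a node is heavy if it has at least d children, and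
-- the rank of a node is the largest number of heavy nodes on a path from it
-- down to a leaf.  (1) Rank is monotone under topological minors, since the
-- children of a node are sent into distinct branches of its image (rank-≼,
-- rank-at).  (2) If every node of T is embedded into U at rank > j, then T is
-- a topological minor of prune j U, which deletes all subtrees of rank ≤ j
-- (prune-≼); each leaf of prune j U is a heavy node of rank exactly j+1
-- (leaves-prune).  (3) Replacing each leaf of a tree with q = ⌊n/s⌋ leaves,
-- s = (j+1)(d-1)+1, by a caterpillar of j+1 heavy nodes yields a tree with n
-- leaves all of whose nodes have rank > j (expand).  So prune j U is
-- q-universal and u(q) ≤ #{heavy nodes of rank j+1}; summing over j gives
-- lemma6.

open import Defs
open import Data.Nat using (ℕ; zero; suc; _+_; _*_; _≤_; _<_; _⊔_; z≤n; s≤s; _≤?_; _/_; _%_)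
open import Data.Nat.Properties
  using ( ≤-refl; ≤-trans; ≤-reflexive; ≤-antisym; ≤-pred; m≤m+n; m≤n+m; m≤m⊔n; m≤n⊔m; ⊔-lub
        ; +-mono-≤; +-monoʳ-≤; *-monoʳ-≤; +-identityʳ; *-identityˡ; *-identityʳ; *-zeroʳ; +-comm; <⇒≱; ≰⇒>; _<?_; +-*-semiring
        ; module ≤-Reasoning)
open import Data.Nat.DivMod using (m≡m%n+[m/n]*n)
open import Data.Nat.Tactic.RingSolver using (solve-∀)
open import Data.Fin using (Fin; toℕ; _≟_) renaming (zero to fzero; suc to fsuc)
open import Data.Fin.Properties using (injective⇒≤; suc-injective; ¬Fin0)
open import Data.Product using (Σ; _×_; _,_; proj₁; proj₂)
open import Data.Empty using (⊥-elim)
open import Relation.Nullary using (Dec; yes; no; ¬_)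
open import Relation.Binary.PropositionalEquality
  using (_≡_; _≢_; refl; sym; trans; cong; cong₂; subst; module ≡-Reasoning)
open import Function.Definitions using (Injective)
open import Algebra.Properties.Semiring.Sum +-*-semiring
  using (sum; sum-cong-≗; ∑-distrib-+; ∑-comm; *-distribˡ-sum; *-distribʳ-sum)

-- Finite sums.  sumFin agrees with the library's `sum`, through which the
-- algebraic laws are imported.

sumFin≡sum : ∀ k (f : Fin k → ℕ) → sumFin k f ≡ sum f
sumFin≡sum zero    f = refl
sumFin≡sum (suc k) f = cong (f fzero +_) (sumFin≡sum k (λ i → f (fsuc i)))

sumFin-cong : ∀ k {f g : Fin k → ℕ} → (∀ i → f i ≡ g i) → sumFin k f ≡ sumFin k g
sumFin-cong zero    f≗g = refl
sumFin-cong (suc k) f≗g = cong₂ _+_ (f≗g fzero) (sumFin-cong k (λ i → f≗g (fsuc i)))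

sumFin-mono : ∀ k {f g : Fin k → ℕ} → (∀ i → f i ≤ g i) → sumFin k f ≤ sumFin k g
sumFin-mono zero    f≤g = z≤n
sumFin-mono (suc k) f≤g = +-mono-≤ (f≤g fzero) (sumFin-mono k (λ i → f≤g (fsuc i)))

sumFin-const : ∀ k c → sumFin k (λ _ → c) ≡ k * c
sumFin-const zero    c = refl
sumFin-const (suc k) c = cong (c +_) (sumFin-const k c)

sumFin-+ : ∀ k (f g : Fin k → ℕ) → sumFin k (λ i → f i + g i) ≡ sumFin k f + sumFin k g
sumFin-+ k f g = begin
  sumFin k (λ i → f i + g i) ≡⟨ sumFin≡sum k _ ⟩
  sum (λ i → f i + g i)      ≡⟨ ∑-distrib-+ f g ⟩
  sum f + sum g              ≡⟨ sym (cong₂ _+_ (sumFin≡sum k f) (sumFin≡sum k g)) ⟩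
  sumFin k f + sumFin k g    ∎
  where open ≡-Reasoning

sumFin-*ˡ : ∀ k c (f : Fin k → ℕ) → sumFin k (λ i → c * f i) ≡ c * sumFin k f
sumFin-*ˡ k c f = begin
  sumFin k (λ i → c * f i) ≡⟨ sumFin≡sum k _ ⟩
  sum (λ i → c * f i)      ≡⟨ sym (*-distribˡ-sum c f) ⟩
  c * sum f                ≡⟨ cong (c *_) (sym (sumFin≡sum k f)) ⟩
  c * sumFin k f           ∎
  where open ≡-Reasoning

sumFin-*ʳ : ∀ k c (f : Fin k → ℕ) → sumFin k (λ i → f i * c) ≡ sumFin k f * c
sumFin-*ʳ k c f = begin
  sumFin k (λ i → f i * c) ≡⟨ sumFin≡sum k _ ⟩
  sum (λ i → f i * c)      ≡⟨ sym (*-distribʳ-sum c f) ⟩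
  sum f * c                ≡⟨ cong (_* c) (sym (sumFin≡sum k f)) ⟩
  sumFin k f * c           ∎
  where open ≡-Reasoning

sumFin-comm : ∀ m k (F : Fin m → Fin k → ℕ) →
              sumFin m (λ i → sumFin k (F i)) ≡ sumFin k (λ c → sumFin m (λ i → F i c))
sumFin-comm m k F = begin
  sumFin m (λ i → sumFin k (F i))       ≡⟨ sumFin≡sum m _ ⟩
  sum (λ i → sumFin k (F i))            ≡⟨ sum-cong-≗ (λ i → sumFin≡sum k (F i)) ⟩
  sum (λ i → sum (F i))                 ≡⟨ ∑-comm F ⟩
  sum (λ c → sum (λ i → F i c))         ≡⟨ sum-cong-≗ (λ c → sym (sumFin≡sum m (λ i → F i c))) ⟩
  sum (λ c → sumFin m (λ i → F i c))    ≡⟨ sym (sumFin≡sum k _) ⟩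
  sumFin k (λ c → sumFin m (λ i → F i c)) ∎
  where open ≡-Reasoning

maxFin : (k : ℕ) → (Fin k → ℕ) → ℕ
maxFin zero    g = 0
maxFin (suc k) g = g fzero ⊔ maxFin k (λ i → g (fsuc i))

maxFin-ub : ∀ k (g : Fin k → ℕ) i → g i ≤ maxFin k g
maxFin-ub (suc k) g fzero    = m≤m⊔n _ _
maxFin-ub (suc k) g (fsuc i) = ≤-trans (maxFin-ub k (λ i → g (fsuc i)) i) (m≤n⊔m _ _)

maxFin-lub : ∀ k (g : Fin k → ℕ) {M} → (∀ i → g i ≤ M) → maxFin k g ≤ M
maxFin-lub zero    g g≤M = z≤n
maxFin-lub (suc k) g g≤M = ⊔-lub (g≤M fzero) (maxFin-lub k (λ i → g (fsuc i)) (λ i → g≤M (fsuc i)))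

countIf : ∀ {A : Set} → Dec A → ℕ → ℕ
countIf (yes _) m = suc m
countIf (no _)  m = m

selectStep : ∀ {A : Set} {k m} (a? : Dec A) → (Fin m → Fin k) → Fin (countIf a? m) → Fin (suc k)
selectStep (yes _) s fzero    = fzero
selectStep (yes _) s (fsuc j) = fsuc (s j)
selectStep (no _)  s j        = fsuc (s j)

kept : ∀ {k} {P : Fin k → Set} → (∀ i → Dec (P i)) → ℕ
kept {zero}  P? = 0
kept {suc k} P? = countIf (P? fzero) (kept (λ i → P? (fsuc i)))

select : ∀ {k} {P : Fin k → Set} (P? : ∀ i → Dec (P i)) → Fin (kept P?) → Fin k
select {suc k} P? = selectStep (P? fzero) (select (λ i → P? (fsuc i)))

select-sound : ∀ {k} {P : Fin k → Set} (P? : ∀ i → Dec (P i)) j → P (select P? j)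
select-sound {suc k} P? j with P? fzero
select-sound {suc k} P? fzero    | yes p = p
select-sound {suc k} P? (fsuc j) | yes _ = select-sound (λ i → P? (fsuc i)) j
select-sound {suc k} P? j        | no _  = select-sound (λ i → P? (fsuc i)) j

select-complete : ∀ {k} {P : Fin k → Set} (P? : ∀ i → Dec (P i)) i → P i → Σ (Fin (kept P?)) λ j → select P? j ≡ i
select-complete {suc k} P? i pi with P? fzero
select-complete {suc k} P? fzero    pi | yes _ = fzero , refl
select-complete {suc k} P? fzero    pi | no ¬p = ⊥-elim (¬p pi)
select-complete {suc k} P? (fsuc i) pi | yes _ with select-complete (λ i → P? (fsuc i)) i pi
... | j , eq = fsuc j , cong fsuc eq
select-complete {suc k} P? (fsuc i) pi | no _ with select-complete (λ i → P? (fsuc i)) i pi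
... | j , eq = j , cong fsuc eq

select-injective : ∀ {k} {P : Fin k → Set} (P? : ∀ i → Dec (P i)) → Injective _≡_ _≡_ (select P?)
select-injective {suc k} P? {j} {j′} eq with P? fzero
select-injective {suc k} P? {fzero}  {fzero}   eq | yes _ = refl
select-injective {suc k} P? {fsuc j} {fsuc j′} eq | yes _ = cong fsuc (select-injective _ (suc-injective eq))
select-injective {suc k} P? {j}      {j′}      eq | no _  = select-injective _ (suc-injective eq)

none-kept : ∀ {k} {P : Fin k → Set} (P? : ∀ i → Dec (P i)) → kept P? ≡ 0 → ∀ i → ¬ P i
none-kept P? none i pi = ¬Fin0 (subst Fin none (proj₁ (select-complete P? i pi)))

sumFin-select : ∀ {k} {P : Fin k → Set} (P? : ∀ i → Dec (P i)) (g : Fin k → ℕ) →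
                sumFin (kept P?) (λ j → g (select P? j)) ≤ sumFin k g
sumFin-select {zero}  P? g = z≤n
sumFin-select {suc k} P? g with P? fzero
... | yes _ = +-monoʳ-≤ (g fzero) (sumFin-select (λ i → P? (fsuc i)) (λ i → g (fsuc i)))
... | no _  = ≤-trans (sumFin-select (λ i → P? (fsuc i)) (λ i → g (fsuc i))) (m≤n+m _ (g fzero))

sub : ∀ {t} → Pos t → Tree
sub {t} root     = t
sub (down i p)   = sub p

graft : ∀ {t} (p : Pos t) → Pos (sub p) → Pos t
graft root       q = q
graft (down i p) q = down i (graft p q)

down-injective : ∀ {k f} {i : Fin k} {p q : Pos (f i)} → down {k} {f} i p ≡ down i q → p ≡ q
down-injective refl = refl

down-index : ∀ {k f} {i j : Fin k} {p : Pos (f i)} {q : Pos (f j)} → down {k} {f} i p ≡ down j q → i ≡ j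
down-index refl = refl

nca-same : ∀ {k f} (i : Fin k) (p q : Pos (f i)) → nca (down {k} {f} i p) (down i q) ≡ down i (nca p q)
nca-same i p q with i ≟ i
... | yes refl = refl
... | no i≢i   = ⊥-elim (i≢i refl)

nca-diff : ∀ {k f} {i j : Fin k} (p : Pos (f i)) (q : Pos (f j)) → i ≢ j → nca (down {k} {f} i p) (down j q) ≡ root
nca-diff {i = i} {j} p q i≢j with i ≟ j
... | yes i≡j = ⊥-elim (i≢j i≡j)
... | no _    = refl

nca-same-branch : ∀ {k f} {i j : Fin k} (p : Pos (f i)) (q : Pos (f j)) → i ≡ j → nca (down {k} {f} i p) (down j q) ≢ root
nca-same-branch {i = i} p q refl eq with () ← trans (sym (nca-same i p q)) eq

graft-root : ∀ {t} (p : Pos t) → graft p root ≡ p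
graft-root root       = refl
graft-root (down i p) = cong (down i) (graft-root p)

graft-injective : ∀ {t} (p : Pos t) → Injective _≡_ _≡_ (graft p)
graft-injective root       eq = eq
graft-injective (down i p) eq = graft-injective p (down-injective eq)

graft-nca : ∀ {t} (p : Pos t) a b → nca (graft p a) (graft p b) ≡ graft p (nca a b)
graft-nca root       a b = refl
graft-nca (down i p) a b = trans (nca-same i _ _) (cong (down i) (graft-nca p a b))

-- The position of q relative to p; meaningful when p is an ancestor of q,
-- i.e. when nca p q ≡ p, in which case grafting it back at p returns q.
relative : ∀ {t} (p q : Pos t) → Pos (sub p)
relative root       q          = q
relative (down i p) root       = root
relative (down i p) (down j q) with i ≟ j
... | yes refl = relative p q
... | no _     = root

-- (The omitted cases have nca p q ≡ root ≢ p and are absurd.)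
graft-relative : ∀ {t} (p q : Pos t) → nca p q ≡ p → graft p (relative p q) ≡ q
graft-relative root       q          _ = refl
graft-relative (down i p) (down j q) e with i ≟ j
... | yes refl = cong (down i) (graft-relative p q (down-injective e))

relative-self : ∀ {t} (p : Pos t) → relative p p ≡ root
relative-self root = refl
relative-self (down i p) with i ≟ i
... | yes refl = relative-self p
... | no i≢i   = ⊥-elim (i≢i refl)

branch : ∀ {k f} (q : Pos (node k f)) → q ≢ root → Σ (Fin k) λ c → Σ (Pos (f c)) λ y → q ≡ down c y
branch root       q≢root = ⊥-elim (q≢root refl)
branch (down c y) _      = c , y , refl

≼-trans : ∀ {T U V} → T ≼ U → U ≼ V → T ≼ V
≼-trans (φ , φ-inj , φ-nca) (ψ , ψ-inj , ψ-nca) =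
  (λ x → ψ (φ x)) , (λ eq → φ-inj (ψ-inj eq)) , (λ x y → trans (cong ψ (φ-nca x y)) (ψ-nca (φ x) (φ y)))

sub-≼ : ∀ {t} (p : Pos t) → sub p ≼ t
sub-≼ p = graft p , graft-injective p , (λ a b → sym (graft-nca p a b))

anchor : ∀ {T U} (e : T ≼ U) → Σ (T ≼ sub (proj₁ e root)) λ e′ → proj₁ e′ root ≡ root
anchor {T} {U} (φ , φ-inj , φ-nca) = (ψ , ψ-inj , ψ-nca) , relative-self (φ root)
  where
  P : Pos U
  P = φ root
  ψ : Pos T → Pos (sub P)
  ψ x = relative P (φ x)
  -- every image lies below P, since nca root x ≡ root
  below : ∀ x → graft P (ψ x) ≡ φ x
  below x = graft-relative P (φ x) (sym (φ-nca root x))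
  ψ-inj : Injective _≡_ _≡_ ψ
  ψ-inj {x} {y} eq = φ-inj (trans (sym (below x)) (trans (cong (graft P) eq) (below y)))
  ψ-nca : ∀ x y → ψ (nca x y) ≡ nca (ψ x) (ψ y)
  ψ-nca x y = graft-injective P (begin
    graft P (ψ (nca x y))                   ≡⟨ below (nca x y) ⟩
    φ (nca x y)                             ≡⟨ φ-nca x y ⟩
    nca (φ x) (φ y)                         ≡⟨ sym (cong₂ nca (below x) (below y)) ⟩
    nca (graft P (ψ x)) (graft P (ψ y))     ≡⟨ graft-nca P (ψ x) (ψ y) ⟩
    graft P (nca (ψ x) (ψ y))               ∎)
    where open ≡-Reasoning

δ : ℕ → ℕ → ℕ
δ zero    zero    = 1
δ zero    (suc _) = 0
δ (suc _) zero    = 0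
δ (suc x) (suc y) = δ x y

δ-refl : ∀ x → δ x x ≡ 1
δ-refl zero    = refl
δ-refl (suc x) = δ-refl x

δ-sum₀ : ∀ n x → sumFin n (λ i → δ x (toℕ i)) ≤ 1
δ-sum₀ zero    x       = z≤n
δ-sum₀ (suc n) zero    = s≤s (≤-reflexive (trans (sumFin-const n 0) (*-zeroʳ n)))
δ-sum₀ (suc n) (suc x) = δ-sum₀ n x

δ-sum : ∀ n x → sumFin n (λ i → δ x (suc (toℕ i))) ≤ 1
δ-sum n zero    = ≤-trans (≤-reflexive (trans (sumFin-const n 0) (*-zeroʳ n))) z≤n
δ-sum n (suc x) = δ-sum₀ n x

leaves-node : ∀ k (f : Fin k → Tree) {Y} → (k ≡ 0 → 1 ≤ Y) → sumFin k (λ i → leaves (f i)) ≤ Y → leaves (node k f) ≤ Y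
leaves-node zero    f childless _ = childless refl
leaves-node (suc k) f _         s = s

module Ranks (d : ℕ) where

  heavy : ℕ → ℕ
  heavy k with d ≤? k
  ... | yes _ = 1
  ... | no _  = 0

  heavy-yes : ∀ {k} → d ≤ k → heavy k ≡ 1
  heavy-yes {k} d≤k with d ≤? k
  ... | yes _   = refl
  ... | no d≰k  = ⊥-elim (d≰k d≤k)

  heavy-mono : ∀ {k k′} → k ≤ k′ → heavy k ≤ heavy k′
  heavy-mono {k} k≤k′ with d ≤? k
  ... | yes d≤k = ≤-reflexive (sym (heavy-yes (≤-trans d≤k k≤k′)))
  ... | no _    = z≤n

  heavy≤1 : ∀ k → heavy k ≤ 1
  heavy≤1 k with d ≤? k
  ... | yes _ = ≤-refl
  ... | no _  = z≤n

  countDeg-node : ∀ k f → countDeg≥ d (node k f) ≡ heavy k + sumFin k (λ i → countDeg≥ d (f i))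
  countDeg-node k f with d ≤? k
  ... | yes _ = refl
  ... | no _  = refl

  rank : Tree → ℕ
  rank (node k f) = heavy k + maxFin k (λ i → rank (f i))

  rank-child : ∀ k f (i : Fin k) → heavy k + rank (f i) ≤ rank (node k f)
  rank-child k f i = +-monoʳ-≤ (heavy k) (maxFin-ub k (λ i → rank (f i)) i)

  rank-sub : ∀ {t} (p : Pos t) → rank (sub p) ≤ rank t
  rank-sub root               = ≤-refl
  rank-sub (down {k} {f} i p) = ≤-trans (rank-sub p) (≤-trans (m≤n+m _ (heavy k)) (rank-child k f i))

  -- For an embedding fixing the
  -- root, the children of T go to distinct branches of U (so T's root has at
  -- most as many children as U's) and each child subtree embeds in its branch.
  rank-rooted : ∀ {T U} (e : T ≼ U) → proj₁ e root ≡ root → rank T ≤ rank U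
  rank-minor  : ∀ {T U} (e : T ≼ U) → rank T ≤ rank (sub (proj₁ e root))

  rank-rooted {node k f} {node m g} e@(φ , φ-inj , φ-nca) φ-root =
    +-mono-≤ (heavy-mono (injective⇒≤ c-injective))
             (maxFin-lub k _ (λ i → ≤-trans (child-rank i) (maxFin-ub m (λ c → rank (g c)) (c i))))
    where
    image≢root : ∀ i → φ (down i root) ≢ root
    image≢root i eq with () ← φ-inj (trans eq (sym φ-root))
    c : Fin k → Fin m
    c i = proj₁ (branch (φ (down i root)) (image≢root i))
    y : ∀ i → Pos (g (c i))
    y i = proj₁ (proj₂ (branch (φ (down i root)) (image≢root i)))
    image≡ : ∀ i → φ (down i root) ≡ down (c i) (y i)
    image≡ i = proj₂ (proj₂ (branch (φ (down i root)) (image≢root i)))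
    c-injective : Injective _≡_ _≡_ c
    c-injective {i} {j} ci≡cj with i ≟ j
    ... | yes i≡j = i≡j
    ... | no i≢j  = ⊥-elim (nca-same-branch (y i) (y j) ci≡cj (begin
      nca (down (c i) (y i)) (down (c j) (y j))   ≡⟨ sym (cong₂ nca (image≡ i) (image≡ j)) ⟩
      nca (φ (down i root)) (φ (down j root))     ≡⟨ sym (φ-nca (down i root) (down j root)) ⟩
      φ (nca (down i root) (down j root))         ≡⟨ cong φ (nca-diff root root i≢j) ⟩
      φ root                                      ≡⟨ φ-root ⟩
      root                                        ∎))
      where open ≡-Reasoning
    child-rank : ∀ i → rank (f i) ≤ rank (g (c i))
    child-rank i = ≤-trans (rank-minor {f i} (≼-trans (sub-≼ (down i root)) e))
                           (≤-trans (≤-reflexive (cong (λ q → rank (sub q)) (image≡ i))) (rank-sub (y i)))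

  rank-minor e = rank-rooted (proj₁ (anchor e)) (proj₂ (anchor e))

  rank-at : ∀ {T U} (e : T ≼ U) (x : Pos T) → rank (sub x) ≤ rank (sub (proj₁ e x))
  rank-at e x = subst (λ p → rank (sub x) ≤ rank (sub (proj₁ e p))) (graft-root x) (rank-minor (≼-trans (sub-≼ x) e))

  rank-≼ : ∀ {T U} → T ≼ U → rank T ≤ rank U
  rank-≼ e = ≤-trans (rank-minor e) (rank-sub (proj₁ e root))

  atRank : ℕ → Tree → ℕ
  atRank r (node k f) = heavy k * δ (rank (node k f)) r + sumFin k (λ i → atRank r (f i))

  -- A heavy node has exactly one rank, so summing over the ranks 1, …, n
  -- counts every heavy node at most once.
  atRank-sum : ∀ n t → sumFin n (λ i → atRank (suc (toℕ i)) t) ≤ countDeg≥ d t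
  atRank-sum n (node k f) = begin
    sumFin n (λ i → heavy k * δ R (suc (toℕ i)) + sumFin k (λ c → atRank (suc (toℕ i)) (f c)))
      ≡⟨ sumFin-+ n _ _ ⟩
    sumFin n (λ i → heavy k * δ R (suc (toℕ i))) + sumFin n (λ i → sumFin k (λ c → atRank (suc (toℕ i)) (f c)))
      ≡⟨ cong₂ _+_ (sumFin-*ˡ n (heavy k) _) (sumFin-comm n k _) ⟩
    heavy k * sumFin n (λ i → δ R (suc (toℕ i))) + sumFin k (λ c → sumFin n (λ i → atRank (suc (toℕ i)) (f c)))
      ≤⟨ +-mono-≤ (*-monoʳ-≤ (heavy k) (δ-sum n R)) (sumFin-mono k (λ c → atRank-sum n (f c))) ⟩
    heavy k * 1 + sumFin k (λ c → countDeg≥ d (f c))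
      ≡⟨ cong (_+ sumFin k (λ c → countDeg≥ d (f c))) (*-identityʳ (heavy k)) ⟩
    heavy k + sumFin k (λ c → countDeg≥ d (f c))
      ≡⟨ sym (countDeg-node k f) ⟩
    countDeg≥ d (node k f) ∎
    where
    open ≤-Reasoning
    R : ℕ
    R = rank (node k f)

  module Pruning (j : ℕ) where

    tall? : ∀ {k} (f : Fin k → Tree) (i : Fin k) → Dec (j < rank (f i))
    tall? f i = j <? rank (f i)

    prune : Tree → Tree
    prune (node k f) = node (kept (tall? f)) (λ c → prune (f (select (tall? f) c)))

    incl : ∀ {t} → Pos (prune t) → Pos t
    incl {node k f} root       = root
    incl {node k f} (down c p) = down (select (tall? f) c) (incl p)

    incl-injective : ∀ {t} → Injective _≡_ _≡_ (incl {t})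
    incl-injective {node k f} {root}     {root}      eq = refl
    incl-injective {node k f} {down c p} {down c′ q} eq with select-injective (tall? f) (down-index eq)
    ... | refl = cong (down c) (incl-injective (down-injective eq))

    incl-nca : ∀ {t} (p q : Pos (prune t)) → incl (nca p q) ≡ nca (incl p) (incl q)
    incl-nca {node k f} root       q           = refl
    incl-nca {node k f} (down c p) root        = refl
    incl-nca {node k f} (down c p) (down c′ q) with c ≟ c′
    ... | yes refl = trans (cong (down _) (incl-nca p q)) (sym (nca-same _ (incl p) (incl q)))
    ... | no c≢c′  = sym (nca-diff (incl p) (incl q) (λ eq → c≢c′ (select-injective (tall? f) eq)))

    lift : ∀ {t} (p : Pos t) → j < rank (sub p) → Σ (Pos (prune t)) λ q → incl q ≡ p
    lift {node k f} root       _    = root , refl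
    lift {node k f} (down i p) tall with lift p tall | select-complete (tall? f) i (≤-trans tall (rank-sub p))
    ... | q , refl | c , refl = down c q , refl

    prune-≼ : ∀ {T U} (e : T ≼ U) → (∀ x → j < rank (sub (proj₁ e x))) → T ≼ prune U
    prune-≼ {T} {U} (φ , φ-inj , φ-nca) tall = ψ , ψ-inj , ψ-nca
      where
      ψ : Pos T → Pos (prune U)
      ψ x = proj₁ (lift (φ x) (tall x))
      incl-ψ : ∀ x → incl (ψ x) ≡ φ x
      incl-ψ x = proj₂ (lift (φ x) (tall x))
      ψ-inj : Injective _≡_ _≡_ ψ
      ψ-inj {x} {y} eq = φ-inj (trans (sym (incl-ψ x)) (trans (cong incl eq) (incl-ψ y)))
      ψ-nca : ∀ x y → ψ (nca x y) ≡ nca (ψ x) (ψ y)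
      ψ-nca x y = incl-injective (begin
        incl (ψ (nca x y))                ≡⟨ incl-ψ (nca x y) ⟩
        φ (nca x y)                       ≡⟨ φ-nca x y ⟩
        nca (φ x) (φ y)                   ≡⟨ sym (cong₂ nca (incl-ψ x) (incl-ψ y)) ⟩
        nca (incl (ψ x)) (incl (ψ y))     ≡⟨ sym (incl-nca (ψ x) (ψ y)) ⟩
        incl (nca (ψ x) (ψ y))            ∎)
        where open ≡-Reasoning

    -- A node of rank > j all of whose children have rank ≤ j is heavy and has rank j+1.
    pinned : ∀ {h M} → h ≤ 1 → M ≤ j → suc j ≤ h + M → h ≡ 1 × h + M ≡ suc j
    pinned z≤n       M≤j j<M = ⊥-elim (<⇒≱ j<M M≤j)
    pinned (s≤s z≤n) M≤j j<M = refl , cong suc (≤-antisym M≤j (≤-pred j<M))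

    leaves-prune : ∀ t → j < rank t → leaves (prune t) ≤ atRank (suc j) t
    leaves-prune (node k f) tall = leaves-node (kept (tall? f)) _ childless (begin
      sumFin (kept (tall? f)) (λ c → leaves (prune (f (select (tall? f) c))))
        ≤⟨ sumFin-mono _ (λ c → leaves-prune (f (select (tall? f) c)) (select-sound (tall? f) c)) ⟩
      sumFin (kept (tall? f)) (λ c → atRank (suc j) (f (select (tall? f) c)))
        ≤⟨ sumFin-select (tall? f) (λ i → atRank (suc j) (f i)) ⟩
      sumFin k (λ i → atRank (suc j) (f i))
        ≤⟨ m≤n+m _ _ ⟩
      atRank (suc j) (node k f) ∎)
      where
      open ≤-Reasoning
      childless : kept (tall? f) ≡ 0 → 1 ≤ atRank (suc j) (node k f)
      childless none = ≤-trans (≤-reflexive (sym own≡1)) (m≤m+n _ _)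
        where
        short : maxFin k (λ i → rank (f i)) ≤ j
        short = maxFin-lub k _ (λ i → ≤-pred (≰⇒> (none-kept (tall? f) none i)))
        forced : heavy k ≡ 1 × rank (node k f) ≡ suc j
        forced = pinned (heavy≤1 k) short tall
        own≡1 : heavy k * δ (rank (node k f)) (suc j) ≡ 1
        own≡1 = trans (cong₂ _*_ (proj₁ forced) (cong (λ x → δ x (suc j)) (proj₂ forced))) (trans (*-identityˡ _) (δ-refl j))

module Gadgets (d′ : ℕ) where

  d : ℕ
  d = suc (suc d′)

  open Ranks d
  open Pruning

  leaf : Tree
  leaf = node 0 (λ ())

  -- Number of leaves of a caterpillar with j+1 heavy nodes: (j+1)(d-1)+1.
  size : ℕ → ℕ
  size j = suc (suc j * suc d′)

  spine : Tree → Fin d → Tree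
  spine t fzero    = t
  spine t (fsuc _) = leaf

  caterpillar : ℕ → ℕ → Tree
  caterpillar zero    e = node (d + e) (λ _ → leaf)
  caterpillar (suc j) e = node d (spine (caterpillar j e))

  leaves-caterpillar : ∀ j e → leaves (caterpillar j e) ≡ size j + e
  leaves-caterpillar zero    e = trans (sumFin-const (d + e) 1) (trans (*-identityʳ (d + e)) (cong (λ x → suc (suc x) + e) (sym (+-identityʳ d′))))
  leaves-caterpillar (suc j) e = begin
    leaves (caterpillar j e) + sumFin (suc d′) (λ _ → 1) ≡⟨ cong₂ _+_ (leaves-caterpillar j e) (trans (sumFin-const (suc d′) 1) (*-identityʳ (suc d′))) ⟩
    size j + e + suc d′                                  ≡⟨ shift (suc j * suc d′) e (suc d′) ⟩
    size (suc j) + e                                     ∎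
    where
    open ≡-Reasoning
    shift : ∀ a e c → suc a + e + c ≡ suc (c + a) + e
    shift = solve-∀

  rank-caterpillar : ∀ j e → suc j ≤ rank (caterpillar j e)
  rank-caterpillar zero    e = subst (_≤ rank (caterpillar zero e)) (heavy-yes (m≤m+n d e)) (m≤m+n _ _)
  rank-caterpillar (suc j) e = begin
    suc (suc j)                     ≤⟨ s≤s (rank-caterpillar j e) ⟩
    1 + rank (caterpillar j e)       ≡⟨ cong (_+ rank (caterpillar j e)) (sym (heavy-yes ≤-refl)) ⟩
    heavy d + rank (caterpillar j e) ≤⟨ rank-child d (spine (caterpillar j e)) fzero ⟩
    rank (caterpillar (suc j) e)     ∎
    where open ≤-Reasoning

  noUnary-caterpillar : ∀ j e → NoUnary (caterpillar j e)
  noUnary-caterpillar zero    e root              ()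
  noUnary-caterpillar zero    e (down _ root)     ()
  noUnary-caterpillar (suc j) e root              ()
  noUnary-caterpillar (suc j) e (down fzero p)    = noUnary-caterpillar j e p
  noUnary-caterpillar (suc j) e (down (fsuc _) root) ()

  surplus : ∀ {k} → ℕ → Fin (suc k) → ℕ
  surplus e fzero    = e
  surplus e (fsuc _) = 0

  expand : ℕ → ℕ → Tree → Tree
  expand j e (node zero    f) = caterpillar j e
  expand j e (node (suc k) f) = node (suc k) (λ i → expand j (surplus e i) (f i))

  leaves-expand : ∀ j e T → leaves (expand j e T) ≡ leaves T * size j + e
  leaves-expand j e (node zero    f) = trans (leaves-caterpillar j e) (cong (_+ e) (sym (*-identityˡ (size j))))
  leaves-expand j e (node (suc k) f) = begin
    sumFin (suc k) (λ i → leaves (expand j (surplus e i) (f i)))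
      ≡⟨ sumFin-cong (suc k) (λ i → leaves-expand j (surplus e i) (f i)) ⟩
    sumFin (suc k) (λ i → leaves (f i) * size j + surplus e i)
      ≡⟨ sumFin-+ (suc k) (λ i → leaves (f i) * size j) (surplus e) ⟩
    sumFin (suc k) (λ i → leaves (f i) * size j) + (e + sumFin k (λ _ → 0))
      ≡⟨ cong₂ _+_ (sumFin-*ʳ (suc k) (size j) (λ i → leaves (f i))) (cong (e +_) (trans (sumFin-const k 0) (*-zeroʳ k))) ⟩
    sumFin (suc k) (λ i → leaves (f i)) * size j + (e + 0)
      ≡⟨ cong (sumFin (suc k) (λ i → leaves (f i)) * size j +_) (+-identityʳ e) ⟩
    leaves (node (suc k) f) * size j + e ∎
    where open ≡-Reasoning

  rank-expand : ∀ j e T → suc j ≤ rank (expand j e T)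
  rank-expand j e (node zero    f) = rank-caterpillar j e
  rank-expand j e (node (suc k) f) =
    ≤-trans (rank-expand j e (f fzero)) (≤-trans (m≤n+m _ _) (rank-child (suc k) (λ i → expand j (surplus e i) (f i)) fzero))

  noUnary-expand : ∀ j e T → NoUnary T → NoUnary (expand j e T)
  noUnary-expand j e (node zero    f) _  = noUnary-caterpillar j e
  noUnary-expand j e (node (suc k) f) nu root       = nu root
  noUnary-expand j e (node (suc k) f) nu (down i p) = noUnary-expand j (surplus e i) (f i) (λ q → nu (down i q)) p

  embed : ∀ j e T → Pos T → Pos (expand j e T)
  embed j e (node zero    f) root       = root
  embed j e (node (suc k) f) root       = root
  embed j e (node (suc k) f) (down i p) = down i (embed j (surplus e i) (f i) p)

  embed-injective : ∀ j e T → Injective _≡_ _≡_ (embed j e T)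
  embed-injective j e (node zero    f) {root}     {root}     _  = refl
  embed-injective j e (node (suc k) f) {root}     {root}     _  = refl
  embed-injective j e (node (suc k) f) {down i p} {down i′ q} eq with down-index eq
  ... | refl = cong (down i) (embed-injective j (surplus e i) (f i) (down-injective eq))

  embed-nca : ∀ j e T (p q : Pos T) → embed j e T (nca p q) ≡ nca (embed j e T p) (embed j e T q)
  embed-nca j e (node zero    f) root       root       = refl
  embed-nca j e (node (suc k) f) root       q          = refl
  embed-nca j e (node (suc k) f) (down i p) root       = refl
  embed-nca j e (node (suc k) f) (down i p) (down i′ q) with i ≟ i′
  ... | yes refl = cong (down i) (embed-nca j (surplus e i) (f i) p q)
  ... | no _     = refl

  expand-≼ : ∀ j e T → T ≼ expand j e T
  expand-≼ j e T = embed j e T , embed-injective j e T , embed-nca j e T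

  rank-embed : ∀ j e T (x : Pos T) → suc j ≤ rank (sub (embed j e T x))
  rank-embed j e (node zero    f) root       = rank-expand j e (node zero f)
  rank-embed j e (node (suc k) f) root       = rank-expand j e (node (suc k) f)
  rank-embed j e (node (suc k) f) (down i p) = rank-embed j (surplus e i) (f i) p

  star : ℕ → Tree
  star zero    = leaf
  star (suc m) = node (suc (suc m)) (λ _ → leaf)

  leaves-star : ∀ m → leaves (star m) ≡ suc m
  leaves-star zero    = refl
  leaves-star (suc m) = trans (sumFin-const (suc (suc m)) 1) (*-identityʳ (suc (suc m)))

  noUnary-star : ∀ m → NoUnary (star m)
  noUnary-star zero    root          ()
  noUnary-star (suc m) root          ()
  noUnary-star (suc m) (down _ root) ()

  expand-leaves : ∀ j n T → leaves T ≡ n / size j → leaves (expand j (n % size j) T) ≡ n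
  expand-leaves j n T leavesT = begin
    leaves (expand j (n % size j) T)         ≡⟨ leaves-expand j (n % size j) T ⟩
    leaves T * size j + n % size j           ≡⟨ cong (λ q → q * size j + n % size j) leavesT ⟩
    n / size j * size j + n % size j         ≡⟨ +-comm (n / size j * size j) (n % size j) ⟩
    n % size j + n / size j * size j         ≡⟨ sym (m≡m%n+[m/n]*n n (size j)) ⟩
    n                                        ∎
    where open ≡-Reasoning

  prune-universal : ∀ j n U → Universal n U → Universal (n / size j) (prune j U)
  prune-universal j n U univ T leavesT noUnaryT = prune-≼ j (≼-trans (expand-≼ j e T) φ) tall
    where
    e : ℕ
    e = n % size j
    φ : expand j e T ≼ U
    φ = univ (expand j e T) (expand-leaves j n T leavesT) (noUnary-expand j e T noUnaryT)
    tall : ∀ x → j < rank (sub (proj₁ φ (embed j e T x)))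
    tall x = ≤-trans (rank-embed j e T x) (rank-at φ (embed j e T x))

  rank-universal : ∀ j n U → Universal n U → ∀ m → n / size j ≡ suc m → j < rank U
  rank-universal j n U univ m q≡ = ≤-trans (rank-expand j e (star m)) (rank-≼ φ)
    where
    e : ℕ
    e = n % size j
    φ : expand j e (star m) ≼ U
    φ = univ (expand j e (star m)) (expand-leaves j n (star m) (trans (leaves-star m) (sym q≡)))
             (noUnary-expand j e (star m) (noUnary-star m))

  u-bound : (u : ℕ → ℕ) → u 0 ≡ 0 → ((m : ℕ) → 1 ≤ m → IsUMin m (u m)) →
            ∀ j n U → Universal n U → u (n / size j) ≤ atRank (suc j) U
  u-bound u u0 uMin j n U univ with n / size j in q≡
  ... | zero  = ≤-trans (≤-reflexive u0) z≤n
  ... | suc m = begin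
    u (suc m)             ≤⟨ proj₂ (uMin (suc m) (s≤s z≤n)) (prune j U) (subst (λ q → Universal q (prune j U)) q≡ (prune-universal j n U univ)) ⟩
    leaves (prune j U)    ≤⟨ leaves-prune j U (rank-universal j n U univ m q≡) ⟩
    atRank (suc j) U      ∎
    where open ≤-Reasoning

lemma6 : (n d : ℕ) → 1 ≤ n → 2 ≤ d →
         (u : ℕ → ℕ) → u 0 ≡ 0 → ((m : ℕ) → 1 ≤ m → IsUMin m (u m)) →
         (U : Tree) → Universal n U →
         boundSum u n d ≤ countDeg≥ d U
lemma6 n (suc (suc d′)) _ (s≤s (s≤s z≤n)) u u0 uMin U univ = begin
  boundSum u n d                                   ≤⟨ sumFin-mono n (λ i → u-bound u u0 uMin (toℕ i) n U univ) ⟩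
  sumFin n (λ i → atRank (suc (toℕ i)) U)          ≤⟨ atRank-sum n U ⟩
  countDeg≥ d U                                    ∎
  where
  open ≤-Reasoning
  open Gadgets d′
  open Ranks d
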